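{- The relation $\{(G,F,G\dot\cup F): G,F\in\mathcal{D},\ G \text{ is loop-full and } F \text{ is loop-free}\}$ is first-order definable in $(\mathcal{D};\sqsubseteq)$ augmented with finitely many finite digraphs as constants.
   Context: Digraphs are pairs $(V,E)$, $V$ nonempty finite, $E\subseteq V^2$ (loops allowed); $\mathcal{D}$ is the set of their isomorphism types; $G\sqsubseteq G'$ means $G$ is isomorphic to an induced substructure of $G'$; $\dot\cup$ is disjoint union. A digraph is loop-full if every vertex has a loop, loop-free if no vertex has a loop. A relation is definable if some first-order formula in the language of partial orders with the constants is satisfied exactly by the tuples of the relation. -}

module Defs where

open import Data.Nat using (ℕ; suc; _+_)
open import Data.Fin using (Fin; splitAt)
open import Data.Bool using (Bool; true; false)
open import Data.Sum using (_⊎_; inj₁; inj₂)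
open import Data.Product using (Σ; _×_)
open import Data.Empty using (⊥)
open import Relation.Binary.PropositionalEquality using (_≡_)
open import Function.Definitions using (Injective; Bijective)
open import Data.Vec.Functional using (Vector; _∷_)

-- A (finite, nonempty) digraph: vertex set Fin (suc size), edge relation E ⊆ V²
-- given as a Boolean matrix; loops are allowed.
record Digraph : Set where
  constructor mkDigraph
  field
    size : ℕ
    edge : Fin (suc size) → Fin (suc size) → Bool

open Digraph public

V : Digraph → Set
V G = Fin (suc (size G))

Preserves : (G H : Digraph) → (V G → V H) → Set
Preserves G H f = ∀ x y → edge G x y ≡ edge H (f x) (f y)

_⊑_ : Digraph → Digraph → Set
G ⊑ H = Σ (V G → V H) λ f → Injective _≡_ _≡_ f × Preserves G H f

_≅_ : Digraph → Digraph → Set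
G ≅ H = Σ (V G → V H) λ f → Bijective _≡_ _≡_ f × Preserves G H f

-- Disjoint union: vertices of G first, then vertices of F.
_∪̇_ : Digraph → Digraph → Digraph
G ∪̇ F = mkDigraph (size G + suc (size F)) e
  where
  e : Fin (suc (size G) + suc (size F)) → Fin (suc (size G) + suc (size F)) → Bool
  e x y with splitAt (suc (size G)) x | splitAt (suc (size G)) y
  ... | inj₁ a | inj₁ b = edge G a b
  ... | inj₂ a | inj₂ b = edge F a b
  ... | inj₁ _ | inj₂ _ = false
  ... | inj₂ _ | inj₁ _ = false

LoopFull : Digraph → Set
LoopFull G = ∀ v → edge G v v ≡ true

LoopFree : Digraph → Set
LoopFree G = ∀ v → edge G v v ≡ false

-- First-order logic in the language {⊑} (with equality) plus c constant
-- symbols; formulas with n free variables (de Bruijn indices).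
data Term (c n : ℕ) : Set where
  var : Fin n → Term c n
  con : Fin c → Term c n

data Formula (c : ℕ) : ℕ → Set where
  ⊥f      : ∀ {n} → Formula c n
  _⊑f_    : ∀ {n} → Term c n → Term c n → Formula c n
  _≈f_    : ∀ {n} → Term c n → Term c n → Formula c n
  ¬f_     : ∀ {n} → Formula c n → Formula c n
  _∧f_    : ∀ {n} → Formula c n → Formula c n → Formula c n
  _∨f_    : ∀ {n} → Formula c n → Formula c n → Formula c n
  _⇒f_    : ∀ {n} → Formula c n → Formula c n → Formula c n
  ∀f      : ∀ {n} → Formula c (suc n) → Formula c n
  ∃f      : ∀ {n} → Formula c (suc n) → Formula c n

-- Semantics in (𝒟; ⊑) with constants interpreted by `cs`; elements of 𝒟 are
-- represented by digraphs, equality of 𝒟 being isomorphism.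
evalT : ∀ {c n} → Vector Digraph c → Vector Digraph n → Term c n → Digraph
evalT cs ρ (var i) = ρ i
evalT cs ρ (con j) = cs j

Sat : ∀ {c n} → Vector Digraph c → Formula c n → Vector Digraph n → Set
Sat cs ⊥f ρ = ⊥
Sat cs (s ⊑f t) ρ = evalT cs ρ s ⊑ evalT cs ρ t
Sat cs (s ≈f t) ρ = evalT cs ρ s ≅ evalT cs ρ t
Sat cs (¬f φ) ρ = Sat cs φ ρ → ⊥
Sat cs (φ ∧f ψ) ρ = Sat cs φ ρ × Sat cs ψ ρ
Sat cs (φ ∨f ψ) ρ = Sat cs φ ρ ⊎ Sat cs ψ ρ
Sat cs (φ ⇒f ψ) ρ = Sat cs φ ρ → Sat cs ψ ρ
Sat cs (∀f φ) ρ = (G : Digraph) → Sat cs φ (G ∷ ρ)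
Sat cs (∃f φ) ρ = Σ Digraph λ G → Sat cs φ (G ∷ ρ)

-- Constants: the one-vertex digraphs Point false (no loop) and Point true
-- (a loop), and the two-vertex digraphs Link p q (vertex 0 looped, vertex 1
-- not, edge 0→1 iff p, edge 1→0 iff q) for (p,q) ≠ (false,false).  The
-- defining formula says:
--   (1) Point false ⋢ G and Point true ⋢ F, i.e. G is loop-full, F loop-free;
--   (2) G ⊑ H and F ⊑ H;
--   (3) no Link p q with p ∨ q embeds in H, i.e. H is *separated*: there is
--       no edge between a looped and an unlooped vertex;
--   (4) every loop-full (loop-free) X ⊑ H already embeds in G (in F).
-- Everything in (1)-(4) holds of G ∪̇ F and is invariant under isomorphism.
-- Conversely the two embeddings of (2) have disjoint images (loops differ),
-- no edges between them (3), and by (4) and a pigeonhole count they cover H,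
-- so they assemble into an isomorphism G ∪̇ F ≅ H.
module Submission where

open import Defs
open import Data.Nat using (ℕ)
open import Data.Product using (Σ; _×_)
open import Data.Vec.Functional using (Vector; _∷_; [])
open import Function.Bundles using (_⇔_)

open import Data.Nat using (suc; _≤_; s≤s⁻¹)
open import Data.Nat.Properties using (1+n≰n)
open import Data.Fin using (Fin; zero; suc; splitAt; join; _↑ˡ_; _↑ʳ_)
open import Data.Fin.Properties
  using (_≟_; any?; injective⇒≤; splitAt-↑ˡ; splitAt-↑ʳ; splitAt⁻¹-↑ˡ; splitAt⁻¹-↑ʳ; join-splitAt; ↑ˡ-injective; ↑ʳ-injective)
open import Data.Bool using (Bool; true; false; not)
open import Data.Bool.Properties using (not-¬; ¬-not) renaming (_≟_ to _≟ᵇ_)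
open import Data.Sum using (_⊎_; inj₁; inj₂; [_,_]′)
open import Data.Product using (_,_; proj₁; proj₂; ∃)
open import Data.Empty using (⊥-elim)
open import Relation.Nullary using (¬_; yes; no)
open import Relation.Binary.PropositionalEquality
  using (_≡_; _≢_; refl; sym; trans; cong; cong₂; module ≡-Reasoning)
open import Function.Base using (_∘_)
open import Function.Definitions using (Injective)
open import Function.Bundles using (mk⇔; Equivalence)
open import Function.Consequences.Propositional using (strictlySurjective⇒surjective)
import Function.Construct.Symmetry as Symmetry

true≢false : true ≢ false
true≢false ()

≅⇒⊑ : ∀ {G H} → G ≅ H → G ⊑ H
≅⇒⊑ (f , (f-inj , _) , f-pres) = f , f-inj , f-pres

⊑-trans : ∀ {G H K} → G ⊑ H → H ⊑ K → G ⊑ K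
⊑-trans (f , f-inj , f-pres) (g , g-inj , g-pres) =
  g ∘ f , f-inj ∘ g-inj , λ x y → trans (f-pres x y) (g-pres (f x) (f y))

≅-sym : ∀ {G H} → G ≅ H → H ≅ G
≅-sym {G} {H} (f , bij , f-pres) = f⁻¹ , Symmetry.bijective bij refl sym trans (cong f) , f⁻¹-pres
  where
  f⁻¹ : V H → V G
  f⁻¹ y = proj₁ (proj₂ bij y)
  f∘f⁻¹ : ∀ y → f (f⁻¹ y) ≡ y
  f∘f⁻¹ y = proj₂ (proj₂ bij y) refl
  f⁻¹-pres : Preserves H G f⁻¹
  f⁻¹-pres y y′ = begin
    edge H y y′                     ≡⟨ sym (cong₂ (edge H) (f∘f⁻¹ y) (f∘f⁻¹ y′)) ⟩
    edge H (f (f⁻¹ y)) (f (f⁻¹ y′)) ≡⟨ sym (f-pres (f⁻¹ y) (f⁻¹ y′)) ⟩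
    edge G (f⁻¹ y) (f⁻¹ y′)         ∎
    where open ≡-Reasoning

⊑-factor : ∀ {X G K} ((ι , _) : G ⊑ K) ((m , _) : X ⊑ K) (s : V X → V G) →
           (∀ u → ι (s u) ≡ m u) → X ⊑ G
⊑-factor {X} {G} {K} (ι , _ , ι-pres) (m , m-inj , m-pres) s ι∘s≡m = s , s-inj , s-pres
  where
  s-inj : Injective _≡_ _≡_ s
  s-inj {u} {v} e = m-inj (trans (sym (ι∘s≡m u)) (trans (cong ι e) (ι∘s≡m v)))
  s-pres : Preserves X G s
  s-pres u v = begin
    edge X u v                 ≡⟨ m-pres u v ⟩
    edge K (m u) (m v)         ≡⟨ sym (cong₂ (edge K) (ι∘s≡m u) (ι∘s≡m v)) ⟩
    edge K (ι (s u)) (ι (s v)) ≡⟨ sym (ι-pres (s u) (s v)) ⟩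
    edge G (s u) (s v)         ∎
    where open ≡-Reasoning

⊑-size : ∀ {X G} → X ⊑ G → size X ≤ size G
⊑-size (_ , m-inj , _) = s≤s⁻¹ (injective⇒≤ m-inj)

Induced : (K : Digraph) {n : ℕ} → (Fin (suc n) → V K) → Digraph
Induced K {n} h = mkDigraph n (λ i j → edge K (h i) (h j))

induced-⊑ : ∀ K {n} {h : Fin (suc n) → V K} → Injective _≡_ _≡_ h → Induced K h ⊑ K
induced-⊑ K {h = h} h-inj = h , h-inj , λ _ _ → refl

∷-injective : ∀ {A : Set} {n} {g : Fin n → A} {y : A} →
              Injective _≡_ _≡_ g → (∀ a → g a ≢ y) → Injective _≡_ _≡_ (y ∷ g)
∷-injective g-inj miss {zero}  {zero}  _ = refl
∷-injective g-inj miss {zero}  {suc b} e = ⊥-elim (miss b (sym e))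
∷-injective g-inj miss {suc a} {zero}  e = ⊥-elim (miss a e)
∷-injective g-inj miss {suc a} {suc b} e = cong suc (g-inj e)

AllLoops : Bool → Digraph → Set
AllLoops b G = ∀ v → edge G v v ≡ b

Point : Bool → Digraph
Point b = mkDigraph 0 (λ _ _ → b)

pointAt : ∀ G {b} (v : V G) → edge G v v ≡ b → Point b ⊑ G
pointAt G v e = (λ _ → v) , (λ { {zero} {zero} _ → refl }) , λ { zero zero → sym e }

allLoops⇔noPoint : ∀ b G → AllLoops b G ⇔ (¬ (Point (not b) ⊑ G))
allLoops⇔noPoint b G = mk⇔ noPoint allLoops
  where
  noPoint : AllLoops b G → ¬ (Point (not b) ⊑ G)
  noPoint loops (m , _ , m-pres) = not-¬ (loops (m zero)) (sym (m-pres zero zero))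
  allLoops : ¬ (Point (not b) ⊑ G) → AllLoops b G
  allLoops noP v with edge G v v ≟ᵇ b
  ... | yes e = e
  ... | no ne = ⊥-elim (noP (pointAt G v (¬-not ne)))

-- If G ⊑ K has only loops b and every subdigraph of K with only loops b
-- embeds in G, then G already contains every vertex of K with loop b:
-- otherwise that vertex together with G gives a larger such subdigraph.
maximal-covers : ∀ {b G K} (gE : G ⊑ K) → AllLoops b G →
                 (∀ X → AllLoops b X → X ⊑ K → X ⊑ G) →
                 ∀ y → edge K y y ≡ b → ∃ λ a → proj₁ gE a ≡ y
maximal-covers {b} {G} {K} (g , g-inj , g-pres) loops maximal y y-loop
  with any? (λ a → g a ≟ y)
... | yes hit = hit
... | no miss = ⊥-elim (1+n≰n (⊑-size {X} {G} (maximal X X-loops X⊑K)))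
  where
  X : Digraph
  X = Induced K (y ∷ g)
  X⊑K : X ⊑ K
  X⊑K = induced-⊑ K (∷-injective g-inj (λ a e → miss (a , e)))
  X-loops : AllLoops b X
  X-loops zero    = y-loop
  X-loops (suc a) = trans (sym (g-pres a a)) (loops a)

linkEdge : Bool → Bool → Fin 2 → Fin 2 → Bool
linkEdge p q zero       zero       = true
linkEdge p q zero       (suc zero) = p
linkEdge p q (suc zero) zero       = q
linkEdge p q (suc zero) (suc zero) = false

Link : Bool → Bool → Digraph
Link p q = mkDigraph 1 (linkEdge p q)

Separated : Digraph → Set
Separated K = ∀ a b → edge K a a ≡ true → edge K b b ≡ false →
              edge K a b ≡ false × edge K b a ≡ false

link⊑ : ∀ K (a b : V K) → edge K a a ≡ true → edge K b b ≡ false →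
        Link (edge K a b) (edge K b a) ⊑ K
link⊑ K a b a-loop b-loop = m , m-inj , m-pres
  where
  m : Fin 2 → V K
  m zero    = a
  m (suc _) = b
  a≢b : a ≢ b
  a≢b e = true≢false (trans (sym a-loop) (trans (cong (λ z → edge K z z) e) b-loop))
  m-inj : Injective _≡_ _≡_ m
  m-inj {zero}       {zero}       _ = refl
  m-inj {zero}       {suc zero}   e = ⊥-elim (a≢b e)
  m-inj {suc zero}   {zero}       e = ⊥-elim (a≢b (sym e))
  m-inj {suc zero}   {suc zero}   _ = refl
  m-pres : Preserves (Link (edge K a b) (edge K b a)) K m
  m-pres zero       zero       = sym a-loop
  m-pres zero       (suc zero) = refl
  m-pres (suc zero) zero       = refl
  m-pres (suc zero) (suc zero) = sym b-loop

linkFree⇒separated : ∀ K → ¬ (Link true false ⊑ K) → ¬ (Link true true ⊑ K) →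
                     ¬ (Link false true ⊑ K) → Separated K
linkFree⇒separated K no10 no11 no01 a b a-loop b-loop
  with link⊑ K a b a-loop b-loop
... | link with edge K a b | edge K b a
...   | false | false = refl , refl
...   | true  | false = ⊥-elim (no10 link)
...   | true  | true  = ⊥-elim (no11 link)
...   | false | true  = ⊥-elim (no01 link)

separated⇒linkFree : ∀ {K} → Separated K → ∀ {p q} → p ≡ true ⊎ q ≡ true → ¬ (Link p q ⊑ K)
separated⇒linkFree sep p∨q (m , _ , m-pres)
  with sep (m zero) (m (suc zero)) (sym (m-pres zero zero)) (sym (m-pres (suc zero) (suc zero)))
... | no-ab , no-ba with p∨q
...   | inj₁ p≡t = true≢false (trans (sym p≡t) (trans (m-pres zero (suc zero)) no-ab))
...   | inj₂ q≡t = true≢false (trans (sym q≡t) (trans (m-pres (suc zero) zero) no-ba))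

sumEdge : (G F : Digraph) → V G ⊎ V F → V G ⊎ V F → Bool
sumEdge G F (inj₁ a) (inj₁ b) = edge G a b
sumEdge G F (inj₂ a) (inj₂ b) = edge F a b
sumEdge G F (inj₁ _) (inj₂ _) = false
sumEdge G F (inj₂ _) (inj₁ _) = false

side : ∀ G F → V (G ∪̇ F) → V G ⊎ V F
side G F = splitAt (suc (size G))

∪̇-edge : ∀ G F x y → edge (G ∪̇ F) x y ≡ sumEdge G F (side G F x) (side G F y)
∪̇-edge G F x y with side G F x | side G F y
... | inj₁ a | inj₁ b = refl
... | inj₂ a | inj₂ b = refl
... | inj₁ a | inj₂ b = refl
... | inj₂ a | inj₁ b = refl

side-injective : ∀ G F → Injective _≡_ _≡_ (side G F)
side-injective G F {x} {y} e = begin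
  x                      ≡⟨ sym (join-splitAt m n x) ⟩
  join m n (side G F x)  ≡⟨ cong (join m n) e ⟩
  join m n (side G F y)  ≡⟨ join-splitAt m n y ⟩
  y                      ∎
  where
  open ≡-Reasoning
  m n : ℕ
  m = suc (size G)
  n = suc (size F)

inl : ∀ G F → G ⊑ (G ∪̇ F)
inl G F = (_↑ˡ n) , ↑ˡ-injective n _ _ , λ a b → sym (begin
    edge (G ∪̇ F) (a ↑ˡ n) (b ↑ˡ n)
      ≡⟨ ∪̇-edge G F (a ↑ˡ n) (b ↑ˡ n) ⟩
    sumEdge G F (side G F (a ↑ˡ n)) (side G F (b ↑ˡ n))
      ≡⟨ cong₂ (sumEdge G F) (splitAt-↑ˡ m a n) (splitAt-↑ˡ m b n) ⟩
    edge G a b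
      ∎)
  where
  open ≡-Reasoning
  m n : ℕ
  m = suc (size G)
  n = suc (size F)

inr : ∀ G F → F ⊑ (G ∪̇ F)
inr G F = (m ↑ʳ_) , ↑ʳ-injective m _ _ , λ a b → sym (begin
    edge (G ∪̇ F) (m ↑ʳ a) (m ↑ʳ b)
      ≡⟨ ∪̇-edge G F (m ↑ʳ a) (m ↑ʳ b) ⟩
    sumEdge G F (side G F (m ↑ʳ a)) (side G F (m ↑ʳ b))
      ≡⟨ cong₂ (sumEdge G F) (splitAt-↑ʳ m n a) (splitAt-↑ʳ m n b) ⟩
    edge F a b
      ∎)
  where
  open ≡-Reasoning
  m n : ℕ
  m = suc (size G)
  n = suc (size F)

-- The union of a loop-full and a loop-free digraph is separated: looped
-- vertices come from G, unlooped ones from F, and there are no cross edges.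
∪̇-separated : ∀ {G F} → LoopFull G → LoopFree F → Separated (G ∪̇ F)
∪̇-separated {G} {F} full free x y x-loop y-loop =
  trans (∪̇-edge G F x y) (proj₁ cross) , trans (∪̇-edge G F y x) (proj₂ cross)
  where
  noCross : ∀ s t → sumEdge G F s s ≡ true → sumEdge G F t t ≡ false →
            sumEdge G F s t ≡ false × sumEdge G F t s ≡ false
  noCross (inj₂ b) _        s-loop _      = ⊥-elim (true≢false (trans (sym s-loop) (free b)))
  noCross (inj₁ _) (inj₁ c) _      t-loop = ⊥-elim (true≢false (trans (sym (full c)) t-loop))
  noCross (inj₁ _) (inj₂ _) _      _      = refl , refl
  cross : sumEdge G F (side G F x) (side G F y) ≡ false × sumEdge G F (side G F y) (side G F x) ≡ false
  cross = noCross (side G F x) (side G F y)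
    (trans (sym (∪̇-edge G F x x)) x-loop) (trans (sym (∪̇-edge G F y y)) y-loop)

looped-in-left : ∀ G F → LoopFree F → ∀ x → edge (G ∪̇ F) x x ≡ true →
                 Σ (V G) λ a → a ↑ˡ suc (size F) ≡ x
looped-in-left G F free x x-loop = bySide (side G F x) refl
  where
  bySide : ∀ s → side G F x ≡ s → Σ (V G) λ a → a ↑ˡ suc (size F) ≡ x
  bySide (inj₁ a) x-side = a , splitAt⁻¹-↑ˡ x-side
  bySide (inj₂ b) x-side = ⊥-elim (true≢false (begin
    true                                   ≡⟨ sym x-loop ⟩
    edge (G ∪̇ F) x x                       ≡⟨ ∪̇-edge G F x x ⟩
    sumEdge G F (side G F x) (side G F x)  ≡⟨ cong (λ s → sumEdge G F s s) x-side ⟩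
    edge F b b                             ≡⟨ free b ⟩
    false                                  ∎))
    where open ≡-Reasoning

unlooped-in-right : ∀ G F → LoopFull G → ∀ x → edge (G ∪̇ F) x x ≡ false →
                    Σ (V F) λ b → suc (size G) ↑ʳ b ≡ x
unlooped-in-right G F full x x-loop = bySide (side G F x) refl
  where
  bySide : ∀ s → side G F x ≡ s → Σ (V F) λ b → suc (size G) ↑ʳ b ≡ x
  bySide (inj₂ b) x-side = b , splitAt⁻¹-↑ʳ x-side
  bySide (inj₁ a) x-side = ⊥-elim (true≢false (begin
    true                                   ≡⟨ sym (full a) ⟩
    edge G a a                             ≡⟨ cong (λ s → sumEdge G F s s) x-side ⟨
    sumEdge G F (side G F x) (side G F x)  ≡⟨ ∪̇-edge G F x x ⟨
    edge (G ∪̇ F) x x                       ≡⟨ x-loop ⟩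
    false                                  ∎))
    where open ≡-Reasoning

loopFull-in-left : ∀ {G F X} → LoopFree F → LoopFull X → X ⊑ (G ∪̇ F) → X ⊑ G
loopFull-in-left {G} {F} {X} free X-full mE@(m , _ , m-pres) =
  ⊑-factor {X} {G} {G ∪̇ F} (inl G F) mE (proj₁ ∘ inLeft) (proj₂ ∘ inLeft)
  where
  inLeft : ∀ u → Σ (V G) λ a → a ↑ˡ suc (size F) ≡ m u
  inLeft u = looped-in-left G F free (m u) (trans (sym (m-pres u u)) (X-full u))

loopFree-in-right : ∀ {G F X} → LoopFull G → LoopFree X → X ⊑ (G ∪̇ F) → X ⊑ F
loopFree-in-right {G} {F} {X} full X-free mE@(m , _ , m-pres) =
  ⊑-factor {X} {F} {G ∪̇ F} (inr G F) mE (proj₁ ∘ inRight) (proj₂ ∘ inRight)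
  where
  inRight : ∀ u → Σ (V F) λ b → suc (size G) ↑ʳ b ≡ m u
  inRight u = unlooped-in-right G F full (m u) (trans (sym (m-pres u u)) (X-free u))

copair-≅ : ∀ {G F K} (gE : G ⊑ K) (fE : F ⊑ K) →
           (∀ a b → proj₁ gE a ≢ proj₁ fE b) →
           (∀ a b → edge K (proj₁ gE a) (proj₁ fE b) ≡ false × edge K (proj₁ fE b) (proj₁ gE a) ≡ false) →
           (∀ y → (∃ λ a → proj₁ gE a ≡ y) ⊎ (∃ λ b → proj₁ fE b ≡ y)) →
           (G ∪̇ F) ≅ K
copair-≅ {G} {F} {K} (g , g-inj , g-pres) (f , f-inj , f-pres) disjoint noCross covers =
  h , (side-injective G F ∘ [g,f]-inj _ _ , strictlySurjective⇒surjective h-hits) , h-pres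
  where
  [g,f] : V G ⊎ V F → V K
  [g,f] = [ g , f ]′
  h : V (G ∪̇ F) → V K
  h = [g,f] ∘ side G F

  [g,f]-inj : ∀ s t → [g,f] s ≡ [g,f] t → s ≡ t
  [g,f]-inj (inj₁ a) (inj₁ b) e = cong inj₁ (g-inj e)
  [g,f]-inj (inj₂ a) (inj₂ b) e = cong inj₂ (f-inj e)
  [g,f]-inj (inj₁ a) (inj₂ b) e = ⊥-elim (disjoint a b e)
  [g,f]-inj (inj₂ b) (inj₁ a) e = ⊥-elim (disjoint a b (sym e))

  [g,f]-pres : ∀ s t → sumEdge G F s t ≡ edge K ([g,f] s) ([g,f] t)
  [g,f]-pres (inj₁ a) (inj₁ b) = g-pres a b
  [g,f]-pres (inj₂ a) (inj₂ b) = f-pres a b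
  [g,f]-pres (inj₁ a) (inj₂ b) = sym (proj₁ (noCross a b))
  [g,f]-pres (inj₂ b) (inj₁ a) = sym (proj₂ (noCross a b))

  h-pres : Preserves (G ∪̇ F) K h
  h-pres x y = trans (∪̇-edge G F x y) ([g,f]-pres (side G F x) (side G F y))

  h-hits : ∀ y → ∃ λ x → h x ≡ y
  h-hits y with covers y
  ... | inj₁ (a , ga≡y) = a ↑ˡ suc (size F) , trans (cong [g,f] (splitAt-↑ˡ (suc (size G)) a _)) ga≡y
  ... | inj₂ (b , fb≡y) = suc (size G) ↑ʳ b , trans (cong [g,f] (splitAt-↑ʳ (suc (size G)) _ b)) fb≡y

maximal-decomposition : ∀ {G F K} → LoopFull G → LoopFree F → Separated K →
  (gE : G ⊑ K) → (fE : F ⊑ K) →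
  (∀ X → LoopFull X → X ⊑ K → X ⊑ G) → (∀ X → LoopFree X → X ⊑ K → X ⊑ F) →
  (G ∪̇ F) ≅ K
maximal-decomposition {G} {F} {K} full free sep gE@(g , _ , g-pres) fE@(f , _ , f-pres) maxG maxF =
  copair-≅ {G} {F} {K} gE fE disjoint (λ a b → sep (g a) (f b) (g-loop a) (f-loop b)) covers
  where
  g-loop : ∀ a → edge K (g a) (g a) ≡ true
  g-loop a = trans (sym (g-pres a a)) (full a)
  f-loop : ∀ b → edge K (f b) (f b) ≡ false
  f-loop b = trans (sym (f-pres b b)) (free b)
  disjoint : ∀ a b → g a ≢ f b
  disjoint a b e = true≢false (trans (sym (g-loop a)) (trans (cong (λ z → edge K z z) e) (f-loop b)))
  covers : ∀ y → (∃ λ a → g a ≡ y) ⊎ (∃ λ b → f b ≡ y)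
  covers y with edge K y y in y-loop
  ... | true  = inj₁ (maximal-covers {true} {G} {K} gE full maxG y y-loop)
  ... | false = inj₂ (maximal-covers {false} {F} {K} fE free maxF y y-loop)

constants : Vector Digraph 5
constants = Point false ∷ Point true ∷ Link true false ∷ Link true true ∷ Link false true ∷ []

pointFalse pointTrue link10 link11 link01 : Fin 5
pointFalse = zero
pointTrue  = suc zero
link10     = suc (suc zero)
link11     = suc (suc (suc zero))
link01     = suc (suc (suc (suc zero)))

𝐆 𝐅 𝐇 : Term 5 3
𝐆 = var zero
𝐅 = var (suc zero)
𝐇 = var (suc (suc zero))

shift : ∀ {c n} → Term c n → Term c (suc n)
shift (var i) = var (suc i)
shift (con j) = con j

avoidersEmbedIn : Fin 5 → Term 5 3 → Formula 5 3
avoidersEmbedIn k T =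
  ∀f (((¬f (con k ⊑f var zero)) ∧f (var zero ⊑f shift 𝐇)) ⇒f (var zero ⊑f shift T))

isDecomposition : Formula 5 3
isDecomposition =
  (¬f (con pointFalse ⊑f 𝐆)) ∧f ((¬f (con pointTrue ⊑f 𝐅)) ∧f
  ((𝐆 ⊑f 𝐇) ∧f ((𝐅 ⊑f 𝐇) ∧f
  ((¬f (con link10 ⊑f 𝐇)) ∧f ((¬f (con link11 ⊑f 𝐇)) ∧f ((¬f (con link01 ⊑f 𝐇)) ∧f
  (avoidersEmbedIn pointFalse 𝐆 ∧f avoidersEmbedIn pointTrue 𝐅)))))))

loopFull⇔ : ∀ G → LoopFull G ⇔ (¬ (Point false ⊑ G))
loopFull⇔ = allLoops⇔noPoint true

loopFree⇔ : ∀ G → LoopFree G ⇔ (¬ (Point true ⊑ G))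
loopFree⇔ = allLoops⇔noPoint false

sound : ∀ G F H → Sat constants isDecomposition (G ∷ F ∷ H ∷ []) →
        LoopFull G × LoopFree F × (H ≅ (G ∪̇ F))
sound G F H (noPointFalse , noPointTrue , G⊑H , F⊑H , no10 , no11 , no01 , maxG , maxF) =
  full , free ,
  ≅-sym {G ∪̇ F} {H} (maximal-decomposition {G} {F} {H} full free
    (linkFree⇒separated H no10 no11 no01) G⊑H F⊑H
    (λ X X-full X⊑H → maxG X (Equivalence.to (loopFull⇔ X) X-full , X⊑H))
    (λ X X-free X⊑H → maxF X (Equivalence.to (loopFree⇔ X) X-free , X⊑H)))
  where
  full : LoopFull G
  full = Equivalence.from (loopFull⇔ G) noPointFalse
  free : LoopFree F
  free = Equivalence.from (loopFree⇔ F) noPointTrue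

complete : ∀ G F H → LoopFull G × LoopFree F × (H ≅ (G ∪̇ F)) →
           Sat constants isDecomposition (G ∷ F ∷ H ∷ [])
complete G F H (full , free , H≅U) =
  Equivalence.to (loopFull⇔ G) full , Equivalence.to (loopFree⇔ F) free ,
  ⊑-trans {G} {U} {H} (inl G F) U⊑H , ⊑-trans {F} {U} {H} (inr G F) U⊑H ,
  noLink (inj₁ refl) , noLink (inj₁ refl) , noLink (inj₂ refl) ,
  (λ X (noPointFalse , X⊑H) → loopFull-in-left {G} {F} {X} free
     (Equivalence.from (loopFull⇔ X) noPointFalse) (⊑-trans {X} {H} {U} X⊑H H⊑U)) ,
  (λ X (noPointTrue , X⊑H) → loopFree-in-right {G} {F} {X} full
     (Equivalence.from (loopFree⇔ X) noPointTrue) (⊑-trans {X} {H} {U} X⊑H H⊑U))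
  where
  U : Digraph
  U = G ∪̇ F
  H⊑U : H ⊑ U
  H⊑U = ≅⇒⊑ {H} {U} H≅U
  U⊑H : U ⊑ H
  U⊑H = ≅⇒⊑ {U} {H} (≅-sym {H} {U} H≅U)
  noLink : ∀ {p q} → p ≡ true ⊎ q ≡ true → ¬ (Link p q ⊑ H)
  noLink {p} {q} p∨q L⊑H =
    separated⇒linkFree {U} (∪̇-separated {G} {F} full free) p∨q (⊑-trans {Link p q} {H} {U} L⊑H H⊑U)

lemma4 : Σ ℕ λ c → Σ (Vector Digraph c) λ cs → Σ (Formula c 3) λ φ →
           ∀ (G F H : Digraph) →
           Sat cs φ (G ∷ F ∷ H ∷ []) ⇔ (LoopFull G × LoopFree F × (H ≅ (G ∪̇ F)))
lemma4 = 5 , constants , isDecomposition , λ G F H → mk⇔ (sound G F H) (complete G F H)
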